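{- Let $H$ be a hypergraph on vertex set $V=\{v_1,\dots,v_n\}$ with edge set $E$, and let $X\subseteq E$. Then $X$ is a spanning forest (resp. spanning tree) of $H$ if and only if there is a map assigning to each $e_k\in X$ a pair $\{v_i,v_j\}$ of distinct vertices with $v_i,v_j\in e_k$, such that the resulting $|X|$ pairs, regarded as edges of the complete graph $K_n$ on $V$, form a forest (resp. a spanning tree) of $K_n$.
   Context: Edges of $H$ are nonempty subsets of $V$. A subset $C\subseteq E$ is a cycle if $|C|=|\bigcup_{e\in C}e|$ and no proper nonempty subset of $C$ has this property. A spanning forest of $H$ is a set of edges containing no cycle; a spanning tree is a spanning forest with exactly $n-1$ edges. -}

module Defs where

open import Data.Nat using (ℕ; zero; suc; _∸_; _≥_)
open import Data.Fin using (Fin)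
import Data.Fin as F
open import Data.Fin.Subset using (Subset; _∈_; _⊆_; _⊂_; ∣_∣; Nonempty; _∪_; ⊥; inside; outside)
open import Data.Vec using ([]; _∷_)
open import Data.List using (List; _++_; length) renaming ([] to []ˡ; _∷_ to _∷ˡ_)
open import Data.List.Relation.Unary.Linked using (Linked)
open import Data.List.Relation.Unary.Unique.Propositional using (Unique)
open import Data.Product using (Σ; ∃; ∃-syntax; _×_; _,_; proj₁; proj₂)
open import Data.Sum using (_⊎_)
open import Relation.Binary.PropositionalEquality using (_≡_; _≢_)
open import Relation.Nullary using (¬_)

-- Hypergraphs: vertex set Fin n, edges indexed by Fin m, edge k is the
-- subset E k of the vertices.  A set of edges is a Subset m.

⋃[_]_ : ∀ {m n} → Subset m → (Fin m → Subset n) → Subset n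
⋃[_]_ {zero}  []            E = ⊥
⋃[_]_ {suc m} (outside ∷ C) E = ⋃[ C ] (λ k → E (F.suc k))
⋃[_]_ {suc m} (inside ∷ C)  E = E F.zero ∪ (⋃[ C ] (λ k → E (F.suc k)))

IsCycle : ∀ {m n} → (Fin m → Subset n) → Subset m → Set
IsCycle E C =
  Nonempty C × ∣ C ∣ ≡ ∣ ⋃[ C ] E ∣ ×
  (∀ D → D ⊂ C → Nonempty D → ∣ D ∣ ≢ ∣ ⋃[ D ] E ∣)

IsSpanningForest : ∀ {m n} → (Fin m → Subset n) → Subset m → Set
IsSpanningForest E X = ∀ C → C ⊆ X → ¬ IsCycle E C

IsSpanningTree : ∀ {m n} → (Fin m → Subset n) → Subset m → Set
IsSpanningTree {n = n} E X = IsSpanningForest E X × ∣ X ∣ ≡ n ∸ 1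

record GraphCycle {n} (Adj : Fin n → Fin n → Set) : Set where
  field
    start : Fin n
    rest  : List (Fin n)
    long  : length rest ≥ 2
    distinct : Unique (start ∷ˡ rest)
    closed : Linked Adj ((start ∷ˡ rest) ++ (start ∷ˡ []ˡ))

IsForestG : ∀ {n} → (Fin n → Fin n → Set) → Set
IsForestG Adj = ¬ GraphCycle Adj

data Walk {n} (Adj : Fin n → Fin n → Set) : Fin n → Fin n → Set where
  here : ∀ {u} → Walk Adj u u
  step : ∀ {u v w} → Adj u v → Walk Adj v w → Walk Adj u w

IsConnectedG : ∀ {n} → (Fin n → Fin n → Set) → Set
IsConnectedG {n} Adj = (u v : Fin n) → Walk Adj u v

IsSpanningTreeG : ∀ {n} → (Fin n → Fin n → Set) → Set
IsSpanningTreeG Adj = IsForestG Adj × IsConnectedG Adj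

SamePair : ∀ {n} → Fin n × Fin n → Fin n × Fin n → Set
SamePair (a , b) (c , d) = (a ≡ c × b ≡ d) ⊎ (a ≡ d × b ≡ c)

-- f k = (i , j) represents the pair {v_i , v_j}; the |X| pairs are distinct
ValidAssignment : ∀ {m n} → (Fin m → Subset n) → Subset m →
                  (Fin m → Fin n × Fin n) → Set
ValidAssignment E X f =
  (∀ k → k ∈ X → proj₁ (f k) ≢ proj₂ (f k) ×
                 proj₁ (f k) ∈ E k × proj₂ (f k) ∈ E k) ×
  (∀ k l → k ∈ X → l ∈ X → SamePair (f k) (f l) → k ≡ l)

PairGraph : ∀ {m n} → Subset m → (Fin m → Fin n × Fin n) →
            Fin n → Fin n → Set
PairGraph X f u v = ∃[ k ] (k ∈ X × SamePair (f k) (u , v))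

-- Call X ⊆ E expanding for a family F of vertex sets if every nonempty C ⊆ X satisfies
-- ∣ C ∣ < ∣ ⋃[ C ] F ∣.  For nonempty edges, X contains no cycle iff it is expanding, since a
-- minimal set violating expansion is a cycle.  An expanding family can be shrunk one vertex at a
-- time until every edge of X has exactly two vertices: if deleting u and deleting w from an edge k
-- with at least three vertices both break expansion, with witnesses C₁ and C₂ (both containing k),
-- then C₁ ∪ C₂ and (C₁ ∩ C₂) - k contradict the submodularity of C ↦ ∣ ⋃[ C ] F ∣.  For a family
-- of pairs, expansion says precisely that the pairs are distinct non-loops forming a forest of K_n:
-- the edges of a graph cycle cover only as many vertices as there are edges, and conversely
-- pruning leaves from a set violating expansion and walking along the rest exhibits a cycle.
-- Finally an expanding X has at most n - 1 edges; with exactly n - 1 every cut of the vertex set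
-- is crossed by an edge, so the forest is connected, while a connected graph has ≥ n - 1 edges.

module Submission where

open import Data.Empty using (⊥-elim)
open import Data.Fin using (Fin; zero; suc; toℕ; _≟_)
open import Data.Fin.Properties using (any?; all?; ¬∀⟶∃¬)
open import Data.Fin.Subset
open import Data.Fin.Subset.Properties
open import Data.List using (List; []; _∷_; _++_; [_]; length; take)
open import Data.List.Membership.Propositional using () renaming (_∈_ to _∈ˡ_)
open import Data.List.Membership.Propositional.Properties using (∈-++⁻; ∈-++⁺ʳ)
open import Data.List.Relation.Unary.All using ([]; _∷_)
open import Data.List.Relation.Unary.All.Properties using (All¬⇒¬Any; ¬Any⇒All¬)
open import Data.List.Relation.Unary.Any using (here; there; index)
import Data.List.Relation.Unary.Any as Any
open import Data.List.Relation.Unary.Linked using (Linked; []; [-]; _∷_)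
open import Data.List.Relation.Unary.Unique.Propositional using (Unique; []; _∷_)
import Data.List.Relation.Unary.Unique.Propositional.Properties as Unique
open import Data.Nat using (ℕ; zero; suc; _+_; _∸_; _≤_; _<_; z≤n; s≤s)
open import Data.Nat.Properties hiding (_≟_)
open import Data.Product using (Σ; ∃; ∃₂; _×_; _,_; proj₁; proj₂)
open import Data.Sum using (_⊎_; inj₁; inj₂; [_,_]′; map₂)
import Data.Vec as Vec
open import Data.Vec.Functional using (foldr; head; tail; updateAt)
open import Data.Vec.Functional.Properties using (updateAt-updates; updateAt-minimal)
open import Data.Vec.Properties using ([]=⇒lookup; lookup⇒[]=; lookup∘tabulate)
open import Function using (_∘_)
open import Function.Bundles using (_⇔_; mk⇔)
open import Function.Definitions using (Injective)
open import Relation.Binary.PropositionalEquality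
  using (_≡_; _≢_; refl; sym; trans; cong; cong₂; subst; module ≡-Reasoning)
open import Relation.Nullary using (¬_; Dec; yes; no)
open import Relation.Nullary.Decidable using (_×-dec_; _⊎-dec_; ¬?; decidable-stable)

open import Defs

private
  variable
    m n : ℕ

<⇒≤∸1 : ∀ {a b} → a < b → a ≤ b ∸ 1
<⇒≤∸1 (s≤s a≤b) = a≤b

x∈p─q⇒x∉q : ∀ {x : Fin n} (p q : Subset n) → x ∈ p ─ q → x ∉ q
x∈p─q⇒x∉q (_ Vec.∷ p) (inside  Vec.∷ q) (Vec.there x∈) (Vec.there x∈q) = x∈p─q⇒x∉q p q x∈ x∈q
x∈p─q⇒x∉q (_ Vec.∷ p) (outside Vec.∷ q) (Vec.there x∈) (Vec.there x∈q) = x∈p─q⇒x∉q p q x∈ x∈q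

x∈p-y⁻ : ∀ {x y : Fin n} (p : Subset n) → x ∈ p - y → x ∈ p × x ≢ y
x∈p-y⁻ {y = y} p x∈ = p─q⊆p p ⁅ y ⁆ x∈ , x∉⁅y⁆⇒x≢y (x∈p─q⇒x∉q p ⁅ y ⁆ x∈)

x∈⁅y⁆∪p⁻ : ∀ {x y : Fin n} (p : Subset n) → x ∈ ⁅ y ⁆ ∪ p → x ≡ y ⊎ x ∈ p
x∈⁅y⁆∪p⁻ {y = y} p x∈ with x∈p∪q⁻ ⁅ y ⁆ p x∈
... | inj₁ x∈⁅y⁆ = inj₁ (x∈⁅y⁆⇒x≡y y x∈⁅y⁆)
... | inj₂ x∈p   = inj₂ x∈p

x∈p⇒⁅x⁆⊆p : ∀ {x : Fin n} {p : Subset n} → x ∈ p → ⁅ x ⁆ ⊆ p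
x∈p⇒⁅x⁆⊆p {x = x} x∈p y∈⁅x⁆ rewrite x∈⁅y⁆⇒x≡y x y∈⁅x⁆ = x∈p

⁅x⁆∪p⊆q : ∀ {x : Fin n} {p q : Subset n} → x ∈ q → p ⊆ q → ⁅ x ⁆ ∪ p ⊆ q
⁅x⁆∪p⊆q {p = p} x∈q p⊆q y∈ with x∈⁅y⁆∪p⁻ p y∈
... | inj₁ refl = x∈q
... | inj₂ y∈p  = p⊆q y∈p

∣p∪q∣+∣p∩q∣≡∣p∣+∣q∣ : ∀ (p q : Subset n) → ∣ p ∪ q ∣ + ∣ p ∩ q ∣ ≡ ∣ p ∣ + ∣ q ∣
∣p∪q∣+∣p∩q∣≡∣p∣+∣q∣ Vec.[] Vec.[] = refl
∣p∪q∣+∣p∩q∣≡∣p∣+∣q∣ (inside Vec.∷ p) (inside Vec.∷ q) =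
  cong suc (trans (+-suc _ _) (trans (cong suc (∣p∪q∣+∣p∩q∣≡∣p∣+∣q∣ p q)) (sym (+-suc _ _))))
∣p∪q∣+∣p∩q∣≡∣p∣+∣q∣ (inside Vec.∷ p) (outside Vec.∷ q) = cong suc (∣p∪q∣+∣p∩q∣≡∣p∣+∣q∣ p q)
∣p∪q∣+∣p∩q∣≡∣p∣+∣q∣ (outside Vec.∷ p) (inside Vec.∷ q) =
  trans (cong suc (∣p∪q∣+∣p∩q∣≡∣p∣+∣q∣ p q)) (sym (+-suc _ _))
∣p∪q∣+∣p∩q∣≡∣p∣+∣q∣ (outside Vec.∷ p) (outside Vec.∷ q) = ∣p∪q∣+∣p∩q∣≡∣p∣+∣q∣ p q

Empty⇒∣p∣≡0 : ∀ {p : Subset n} → Empty p → ∣ p ∣ ≡ 0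
Empty⇒∣p∣≡0 {n} p-empty rewrite Empty-unique p-empty = ∣⊥∣≡0 n

∣p∪q∣≤∣p∣+∣q∣ : ∀ (p q : Subset n) → ∣ p ∪ q ∣ ≤ ∣ p ∣ + ∣ q ∣
∣p∪q∣≤∣p∣+∣q∣ p q = subst (∣ p ∪ q ∣ ≤_) (∣p∪q∣+∣p∩q∣≡∣p∣+∣q∣ p q) (m≤m+n _ _)

disjoint⇒∣p∪q∣≡∣p∣+∣q∣ : ∀ (p q : Subset n) → (∀ {x} → x ∈ p → x ∉ q) → ∣ p ∪ q ∣ ≡ ∣ p ∣ + ∣ q ∣
disjoint⇒∣p∪q∣≡∣p∣+∣q∣ p q disjoint = begin
  ∣ p ∪ q ∣               ≡⟨ +-identityʳ _ ⟨
  ∣ p ∪ q ∣ + 0           ≡⟨ cong (∣ p ∪ q ∣ +_) (Empty⇒∣p∣≡0 p∩q-empty) ⟨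
  ∣ p ∪ q ∣ + ∣ p ∩ q ∣   ≡⟨ ∣p∪q∣+∣p∩q∣≡∣p∣+∣q∣ p q ⟩
  ∣ p ∣ + ∣ q ∣           ∎
  where
  open ≡-Reasoning
  p∩q-empty : Empty (p ∩ q)
  p∩q-empty (x , x∈) = let x∈p , x∈q = x∈p∩q⁻ p q x∈ in disjoint x∈p x∈q

x∉p⇒∣⁅x⁆∪p∣≡1+∣p∣ : ∀ {x : Fin n} (p : Subset n) → x ∉ p → ∣ ⁅ x ⁆ ∪ p ∣ ≡ suc ∣ p ∣
x∉p⇒∣⁅x⁆∪p∣≡1+∣p∣ {x = x} p x∉p =
  trans (disjoint⇒∣p∪q∣≡∣p∣+∣q∣ ⁅ x ⁆ p (λ y∈⁅x⁆ → x∉p ∘ subst (_∈ p) (x∈⁅y⁆⇒x≡y x y∈⁅x⁆)))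
        (cong (_+ ∣ p ∣) (∣⁅x⁆∣≡1 x))

x∈p⇒∣p∣≡1+∣p-x∣ : ∀ {x : Fin n} (p : Subset n) → x ∈ p → ∣ p ∣ ≡ suc ∣ p - x ∣
x∈p⇒∣p∣≡1+∣p-x∣ {x = x} p x∈p =
  trans (cong ∣_∣ p≡⁅x⁆∪[p-x]) (x∉p⇒∣⁅x⁆∪p∣≡1+∣p∣ (p - x) (λ x∈ → proj₂ (x∈p-y⁻ p x∈) refl))
  where
  p≡⁅x⁆∪[p-x] : p ≡ ⁅ x ⁆ ∪ (p - x)
  p≡⁅x⁆∪[p-x] = ⊆-antisym ⊆⁅x⁆∪[p-x] (⁅x⁆∪p⊆q x∈p (p─q⊆p p ⁅ x ⁆))
    where
    ⊆⁅x⁆∪[p-x] : p ⊆ ⁅ x ⁆ ∪ (p - x)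
    ⊆⁅x⁆∪[p-x] {y} y∈p with y ≟ x
    ... | yes refl = x∈p∪q⁺ (inj₁ (x∈⁅x⁆ x))
    ... | no y≢x   = x∈p∪q⁺ (inj₂ (x∈p∧x≢y⇒x∈p-y y∈p y≢x))

∣p∣≡∣p∩q∣+∣p∩∁q∣ : ∀ (p q : Subset n) → ∣ p ∣ ≡ ∣ p ∩ q ∣ + ∣ p ∩ ∁ q ∣
∣p∣≡∣p∩q∣+∣p∩∁q∣ Vec.[] Vec.[] = refl
∣p∣≡∣p∩q∣+∣p∩∁q∣ (inside  Vec.∷ p) (inside  Vec.∷ q) = cong suc (∣p∣≡∣p∩q∣+∣p∩∁q∣ p q)
∣p∣≡∣p∩q∣+∣p∩∁q∣ (inside  Vec.∷ p) (outside Vec.∷ q) =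
  trans (cong suc (∣p∣≡∣p∩q∣+∣p∩∁q∣ p q)) (sym (+-suc _ _))
∣p∣≡∣p∩q∣+∣p∩∁q∣ (outside Vec.∷ p) (_       Vec.∷ q) = ∣p∣≡∣p∩q∣+∣p∩∁q∣ p q

preimage : (Fin m → Fin n) → Subset n → Subset m
preimage g T = Vec.tabulate (Vec.lookup T ∘ g)

∈preimage⁺ : ∀ {g : Fin m → Fin n} {T k} → g k ∈ T → k ∈ preimage g T
∈preimage⁺ {g = g} {T} {k} gk∈T =
  lookup⇒[]= k _ (trans (lookup∘tabulate (Vec.lookup T ∘ g) k) ([]=⇒lookup gk∈T))

∈preimage⁻ : ∀ {g : Fin m → Fin n} {T k} → k ∈ preimage g T → g k ∈ T
∈preimage⁻ {g = g} {T} {k} k∈ =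
  lookup⇒[]= (g k) T (trans (sym (lookup∘tabulate (Vec.lookup T ∘ g) k)) ([]=⇒lookup k∈))

x∈p⇒0<∣p∣ : ∀ {x : Fin n} (p : Subset n) → x ∈ p → 0 < ∣ p ∣
x∈p⇒0<∣p∣ p x∈p rewrite x∈p⇒∣p∣≡1+∣p-x∣ p x∈p = s≤s z≤n

0<∣p∣⇒Nonempty : ∀ (p : Subset n) → 0 < ∣ p ∣ → Nonempty p
0<∣p∣⇒Nonempty p 0<∣p∣ with nonempty? p
... | yes p-nonempty = p-nonempty
... | no  p-empty    = ⊥-elim (<-irrefl (sym (Empty⇒∣p∣≡0 p-empty)) 0<∣p∣)

∈⋃⁻ : ∀ {x : Fin n} (C : Subset m) (F : Fin m → Subset n) → x ∈ ⋃[ C ] F → ∃ λ k → k ∈ C × x ∈ F k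
∈⋃⁻ {m = zero} Vec.[] F x∈ = ⊥-elim (∉⊥ x∈)
∈⋃⁻ {m = suc m} (outside Vec.∷ C) F x∈ =
  let k , k∈C , x∈Fk = ∈⋃⁻ C (F ∘ suc) x∈ in suc k , Vec.there k∈C , x∈Fk
∈⋃⁻ {m = suc m} (inside Vec.∷ C) F x∈ with x∈p∪q⁻ (F zero) _ x∈
... | inj₁ x∈F0 = zero , Vec.here , x∈F0
... | inj₂ x∈⋃ = let k , k∈C , x∈Fk = ∈⋃⁻ C (F ∘ suc) x∈⋃ in suc k , Vec.there k∈C , x∈Fk

∈⋃⁺ : ∀ {x : Fin n} {k : Fin m} (C : Subset m) (F : Fin m → Subset n) → k ∈ C → x ∈ F k → x ∈ ⋃[ C ] F
∈⋃⁺ (inside  Vec.∷ C) F Vec.here        x∈ = x∈p∪q⁺ (inj₁ x∈)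
∈⋃⁺ (inside  Vec.∷ C) F (Vec.there k∈C) x∈ = x∈p∪q⁺ (inj₂ (∈⋃⁺ C (F ∘ suc) k∈C x∈))
∈⋃⁺ (outside Vec.∷ C) F (Vec.there k∈C) x∈ = ∈⋃⁺ C (F ∘ suc) k∈C x∈

⋃⊆ : ∀ {C : Subset m} {F : Fin m → Subset n} {S : Subset n} → (∀ {k} → k ∈ C → F k ⊆ S) → ⋃[ C ] F ⊆ S
⋃⊆ {C = C} {F} F⊆S x∈ = let k , k∈C , x∈Fk = ∈⋃⁻ C F x∈ in F⊆S k∈C x∈Fk

⋃-monoˡ : ∀ {C D : Subset m} (F : Fin m → Subset n) → C ⊆ D → ⋃[ C ] F ⊆ ⋃[ D ] F
⋃-monoˡ {D = D} F C⊆D = ⋃⊆ (λ k∈C → ∈⋃⁺ D F (C⊆D k∈C))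

⋃-monoʳ : ∀ (C : Subset m) {F G : Fin m → Subset n} → (∀ {k} → k ∈ C → F k ⊆ G k) → ⋃[ C ] F ⊆ ⋃[ C ] G
⋃-monoʳ C {G = G} F⊆G = ⋃⊆ (λ k∈C x∈ → ∈⋃⁺ C G k∈C (F⊆G k∈C x∈))

⋃[⁅k⁆]⊆ : ∀ (F : Fin m → Subset n) k → ⋃[ ⁅ k ⁆ ] F ⊆ F k
⋃[⁅k⁆]⊆ F k = ⋃⊆ (λ j∈⁅k⁆ → subst (λ j → F j ⊆ F k) (sym (x∈⁅y⁆⇒x≡y k j∈⁅k⁆)) (λ x∈ → x∈))

-- Expanding edge sets and cycles

Expanding : Subset m → (Fin m → Subset n) → Set
Expanding X F = ∀ C → C ⊆ X → Nonempty C → ∣ C ∣ < ∣ ⋃[ C ] F ∣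

Deficient : Subset m → (Fin m → Subset n) → Subset m → Set
Deficient X F C = C ⊆ X × Nonempty C × ∣ ⋃[ C ] F ∣ ≤ ∣ C ∣

deficient? : ∀ (X : Subset m) (F : Fin m → Subset n) C → Dec (Deficient X F C)
deficient? X F C = C ⊆? X ×-dec nonempty? C ×-dec ∣ ⋃[ C ] F ∣ ≤? ∣ C ∣

¬Deficient⇒< : ∀ {X C : Subset m} {F : Fin m → Subset n} →
               ¬ Deficient X F C → C ⊆ X → Nonempty C → ∣ C ∣ < ∣ ⋃[ C ] F ∣
¬Deficient⇒< ¬deficient C⊆X C-nonempty = ≰⇒> (λ ≤ → ¬deficient (C⊆X , C-nonempty , ≤))

expanding? : ∀ (X : Subset m) (F : Fin m → Subset n) → Expanding X F ⊎ ∃ (Deficient X F)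
expanding? X F with anySubset? (deficient? X F)
... | yes deficient = inj₂ deficient
... | no ¬deficient = inj₁ (λ C → ¬Deficient⇒< (¬deficient ∘ (C ,_)))

Expanding-mono : ∀ {X : Subset m} {F G : Fin m → Subset n} →
                 (∀ {k} → k ∈ X → F k ⊆ G k) → Expanding X F → Expanding X G
Expanding-mono F⊆G expanding C C⊆X C-nonempty =
  <-≤-trans (expanding C C⊆X C-nonempty) (p⊆q⇒∣p∣≤∣q∣ (⋃-monoʳ C (F⊆G ∘ C⊆X)))

module _ {X : Subset m} {F : Fin m → Subset n} (expanding : Expanding X F) where

  expanding⇒∣C∣<∣S∣ : ∀ {C S} → C ⊆ X → ⋃[ C ] F ⊆ S → Nonempty S → ∣ C ∣ < ∣ S ∣
  expanding⇒∣C∣<∣S∣ {C} {S} C⊆X ⋃C⊆S (x , x∈S) with nonempty? C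
  ... | yes C-nonempty = <-≤-trans (expanding C C⊆X C-nonempty) (p⊆q⇒∣p∣≤∣q∣ ⋃C⊆S)
  ... | no  C-empty    = subst (_< ∣ S ∣) (sym (Empty⇒∣p∣≡0 C-empty)) (x∈p⇒0<∣p∣ S x∈S)

  expanding⇒2≤∣F∣ : ∀ {k} → k ∈ X → 2 ≤ ∣ F k ∣
  expanding⇒2≤∣F∣ {k} k∈X = subst (_< ∣ F k ∣) (∣⁅x⁆∣≡1 k)
    (<-≤-trans (expanding ⁅ k ⁆ (x∈p⇒⁅x⁆⊆p k∈X) (k , x∈⁅x⁆ k)) (p⊆q⇒∣p∣≤∣q∣ (⋃[⁅k⁆]⊆ F k)))

  expanding⇒∣X∣≤n∸1 : ∣ X ∣ ≤ n ∸ 1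
  expanding⇒∣X∣≤n∸1 with nonempty? X
  ... | yes X-nonempty = <⇒≤∸1 (<-≤-trans (expanding X (λ k∈ → k∈) X-nonempty) (∣p∣≤n (⋃[ X ] F)))
  ... | no  X-empty    = subst (_≤ n ∸ 1) (sym (Empty⇒∣p∣≡0 X-empty)) z≤n

expanding⇒forest : ∀ {E : Fin m → Subset n} {X} → Expanding X E → IsSpanningForest E X
expanding⇒forest expanding C C⊆X (C-nonempty , ∣C∣≡∣⋃C∣ , _) =
  <-irrefl ∣C∣≡∣⋃C∣ (expanding C C⊆X C-nonempty)

module _ {E : Fin m → Subset n} (edges-nonempty : ∀ k → Nonempty (E k)) where

  minimal-deficient⇒cycle : ∀ {C} → Nonempty C → ∣ ⋃[ C ] E ∣ ≤ ∣ C ∣ →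
    (∀ D → D ⊆ C → ∣ D ∣ < ∣ C ∣ → Nonempty D → ∣ D ∣ < ∣ ⋃[ D ] E ∣) → IsCycle E C
  minimal-deficient⇒cycle {C} C-nonempty@(j , j∈C) ∣⋃C∣≤∣C∣ proper-expanding =
    C-nonempty , ≤-antisym ∣C∣≤∣⋃C∣ ∣⋃C∣≤∣C∣ , minimal
    where
    ∣C∣≤∣⋃C∣ : ∣ C ∣ ≤ ∣ ⋃[ C ] E ∣
    ∣C∣≤∣⋃C∣ = subst (_≤ ∣ ⋃[ C ] E ∣) (sym (x∈p⇒∣p∣≡1+∣p-x∣ C j∈C)) ∣C-j∣<∣⋃C∣
      where
      ∣C-j∣<∣⋃C∣ : ∣ C - j ∣ < ∣ ⋃[ C ] E ∣
      ∣C-j∣<∣⋃C∣ with nonempty? (C - j)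
      ... | yes C-j-nonempty = <-≤-trans
            (proper-expanding (C - j) (p─q⊆p C ⁅ j ⁆) (x∈p⇒∣p-x∣<∣p∣ j∈C) C-j-nonempty)
            (p⊆q⇒∣p∣≤∣q∣ (⋃-monoˡ E (p─q⊆p C ⁅ j ⁆)))
      ... | no  C-j-empty = subst (_< ∣ ⋃[ C ] E ∣) (sym (Empty⇒∣p∣≡0 C-j-empty))
            (x∈p⇒0<∣p∣ (⋃[ C ] E) (∈⋃⁺ C E j∈C (proj₂ (edges-nonempty j))))
    minimal : ∀ D → D ⊂ C → Nonempty D → ∣ D ∣ ≢ ∣ ⋃[ D ] E ∣
    minimal D D⊂C D-nonempty ∣D∣≡∣⋃D∣ =
      <-irrefl ∣D∣≡∣⋃D∣ (proper-expanding D (p⊂q⇒p⊆q D⊂C) (p⊂q⇒∣p∣<∣q∣ D⊂C) D-nonempty)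

  deficient⇒cycle : ∀ s C → ∣ C ∣ ≤ s → Nonempty C → ∣ ⋃[ C ] E ∣ ≤ ∣ C ∣ → ∃ λ D → D ⊆ C × IsCycle E D
  deficient⇒cycle s C ∣C∣≤s C-nonempty ∣⋃C∣≤∣C∣
    with anySubset? (λ D → deficient? C E D ×-dec ∣ D ∣ <? ∣ C ∣)
  ... | no no-proper = C , (λ k∈ → k∈) , minimal-deficient⇒cycle C-nonempty ∣⋃C∣≤∣C∣
    (λ D D⊆C ∣D∣<∣C∣ → ¬Deficient⇒< (λ deficient → no-proper (D , deficient , ∣D∣<∣C∣)) D⊆C)
  deficient⇒cycle zero C ∣C∣≤0 _ _ | yes (_ , _ , ∣D∣<∣C∣) = ⊥-elim (n≮0 (<-≤-trans ∣D∣<∣C∣ ∣C∣≤0))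
  deficient⇒cycle (suc s) C ∣C∣≤1+s _ _ | yes (D , (D⊆C , D-nonempty , ∣⋃D∣≤∣D∣) , ∣D∣<∣C∣) =
    let D′ , D′⊆D , cycle = deficient⇒cycle s D (≤-pred (<-≤-trans ∣D∣<∣C∣ ∣C∣≤1+s)) D-nonempty ∣⋃D∣≤∣D∣
    in D′ , D⊆C ∘ D′⊆D , cycle

  forest⇒expanding : ∀ {X} → IsSpanningForest E X → Expanding X E
  forest⇒expanding {X} forest with expanding? X E
  ... | inj₁ expanding = expanding
  ... | inj₂ (C , C⊆X , C-nonempty , ∣⋃C∣≤∣C∣) =
    let D , D⊆C , cycle = deficient⇒cycle m C (∣p∣≤n C) C-nonempty ∣⋃C∣≤∣C∣
    in ⊥-elim (forest D (C⊆X ∘ D⊆C) cycle)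

endpoints : Fin n × Fin n → Subset n
endpoints (a , b) = ⁅ a ⁆ ∪ ⁅ b ⁆

∈endpoints⁻ : ∀ {x : Fin n} ab → x ∈ endpoints ab → x ≡ proj₁ ab ⊎ x ≡ proj₂ ab
∈endpoints⁻ (a , b) x∈ = map₂ (x∈⁅y⁆⇒x≡y b) (x∈⁅y⁆∪p⁻ ⁅ b ⁆ x∈)

proj₁∈endpoints : ∀ (ab : Fin n × Fin n) → proj₁ ab ∈ endpoints ab
proj₁∈endpoints (a , b) = x∈p∪q⁺ (inj₁ (x∈⁅x⁆ a))

proj₂∈endpoints : ∀ (ab : Fin n × Fin n) → proj₂ ab ∈ endpoints ab
proj₂∈endpoints (a , b) = x∈p∪q⁺ (inj₂ (x∈⁅x⁆ b))

endpoints⊆ : ∀ {ab : Fin n × Fin n} {p} → proj₁ ab ∈ p → proj₂ ab ∈ p → endpoints ab ⊆ p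
endpoints⊆ a∈p b∈p = ⁅x⁆∪p⊆q a∈p (x∈p⇒⁅x⁆⊆p b∈p)

∣endpoints∣≤2 : ∀ (ab : Fin n × Fin n) → ∣ endpoints ab ∣ ≤ 2
∣endpoints∣≤2 (a , b) = subst (∣ endpoints (a , b) ∣ ≤_) (cong₂ _+_ (∣⁅x⁆∣≡1 a) (∣⁅x⁆∣≡1 b))
  (∣p∪q∣≤∣p∣+∣q∣ ⁅ a ⁆ ⁅ b ⁆)

∣endpoints∣≡2 : ∀ {a b : Fin n} → a ≢ b → ∣ endpoints (a , b) ∣ ≡ 2
∣endpoints∣≡2 {a = a} {b} a≢b =
  trans (x∉p⇒∣⁅x⁆∪p∣≡1+∣p∣ ⁅ b ⁆ (a≢b ∘ x∈⁅y⁆⇒x≡y b)) (cong suc (∣⁅x⁆∣≡1 b))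

two-elements : ∀ (p : Subset n) → 2 ≤ ∣ p ∣ → ∃₂ λ u w → u ∈ p × w ∈ p - u
two-elements p 2≤∣p∣ =
  let u , u∈p = 0<∣p∣⇒Nonempty p (≤-trans (s≤s z≤n) 2≤∣p∣)
      w , w∈p-u = 0<∣p∣⇒Nonempty (p - u) (≤-pred (subst (2 ≤_) (x∈p⇒∣p∣≡1+∣p-x∣ p u∈p) 2≤∣p∣))
  in u , w , u∈p , w∈p-u

∣p∣≡2⇒p≡endpoints : ∀ (p : Subset n) → ∣ p ∣ ≡ 2 → ∃ λ ab → p ≡ endpoints ab
∣p∣≡2⇒p≡endpoints p ∣p∣≡2 with two-elements p (≤-reflexive (sym ∣p∣≡2))
... | a , b , a∈p , b∈p-a = (a , b) , ⊆-antisym p⊆ab (endpoints⊆ a∈p (proj₁ (x∈p-y⁻ p b∈p-a)))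
  where
  ∣p-a-b∣≡0 : ∣ p - a - b ∣ ≡ 0
  ∣p-a-b∣≡0 = suc-injective (suc-injective (begin
    2 + ∣ p - a - b ∣ ≡⟨ cong suc (x∈p⇒∣p∣≡1+∣p-x∣ (p - a) b∈p-a) ⟨
    1 + ∣ p - a ∣     ≡⟨ x∈p⇒∣p∣≡1+∣p-x∣ p a∈p ⟨
    ∣ p ∣             ≡⟨ ∣p∣≡2 ⟩
    2                 ∎))
    where open ≡-Reasoning
  p⊆ab : p ⊆ endpoints (a , b)
  p⊆ab {x} x∈p with x ≟ a | x ≟ b
  ... | yes refl | _        = proj₁∈endpoints (a , b)
  ... | no _     | yes refl = proj₂∈endpoints (a , b)
  ... | no x≢a   | no x≢b   = ⊥-elim (<-irrefl (sym ∣p-a-b∣≡0)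
          (x∈p⇒0<∣p∣ (p - a - b) (x∈p∧x≢y⇒x∈p-y (x∈p∧x≢y⇒x∈p-y x∈p x≢a) x≢b)))

-- Shrinking edges to pairs

weight : (Fin m → Subset n) → ℕ
weight = foldr (λ S w → ∣ S ∣ + w) 0

weight-updateAt-< : ∀ (F : Fin m → Subset n) k {g} → ∣ g (F k) ∣ < ∣ F k ∣ →
                    weight (updateAt F k g) < weight F
weight-updateAt-< F zero    ∣gFk∣<∣Fk∣ = +-monoˡ-< (weight (tail F)) ∣gFk∣<∣Fk∣
weight-updateAt-< F (suc k) ∣gFk∣<∣Fk∣ = +-monoʳ-< ∣ head F ∣ (weight-updateAt-< (tail F) k ∣gFk∣<∣Fk∣)

module _ (F : Fin m → Subset n) (k : Fin m) {v : Fin n} where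

  ⊆-updateAt : ∀ {j} → j ≢ k → F j ⊆ updateAt F k (_- v) j
  ⊆-updateAt {j} j≢k = subst (_ ∈_) (sym (updateAt-minimal j k F j≢k))

  ∈-updateAt-updates⁺ : ∀ {x} → x ∈ F k - v → x ∈ updateAt F k (_- v) k
  ∈-updateAt-updates⁺ = subst (_ ∈_) (sym (updateAt-updates k F))

  updateAt-⊆ : ∀ j → updateAt F k (_- v) j ⊆ F j
  updateAt-⊆ j with j ≟ k
  ... | yes refl = p─q⊆p (F k) ⁅ v ⁆ ∘ subst (_ ∈_) (updateAt-updates k F)
  ... | no j≢k   = subst (_ ∈_) (updateAt-minimal j k F j≢k)

module _ (F : Fin m → Subset n) (k : Fin m) (u w : Fin n) {C₁ C₂ : Subset m} (k∈C₁ : k ∈ C₁) (k∈C₂ : k ∈ C₂)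
  where

  private
    S₁ = ⋃[ C₁ ] updateAt F k (_- u)
    S₂ = ⋃[ C₂ ] updateAt F k (_- w)

    ∈S₂ : ∀ {x} → x ∈ F k → x ≢ w → x ∈ S₂
    ∈S₂ x∈Fk x≢w = ∈⋃⁺ C₂ _ k∈C₂ (∈-updateAt-updates⁺ F k (x∈p∧x≢y⇒x∈p-y x∈Fk x≢w))

  ⋃-∪-deletions : w ≢ u → ⋃[ C₁ ∪ C₂ ] F ⊆ S₁ ∪ S₂
  ⋃-∪-deletions w≢u = ⋃⊆ λ {j} j∈C₁∪C₂ {x} x∈Fj → x∈p∪q⁺ (cover j∈C₁∪C₂ x∈Fj (j ≟ k) (x ≟ u))
    where
    cover : ∀ {j x} → j ∈ C₁ ∪ C₂ → x ∈ F j → Dec (j ≡ k) → Dec (x ≡ u) → x ∈ S₁ ⊎ x ∈ S₂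
    cover _ x∈Fk (yes refl) (yes refl) = inj₂ (∈S₂ x∈Fk (w≢u ∘ sym))
    cover _ x∈Fk (yes refl) (no x≢u)   =
      inj₁ (∈⋃⁺ C₁ _ k∈C₁ (∈-updateAt-updates⁺ F k (x∈p∧x≢y⇒x∈p-y x∈Fk x≢u)))
    cover j∈C₁∪C₂ x∈Fj (no j≢k) _ with x∈p∪q⁻ C₁ C₂ j∈C₁∪C₂
    ... | inj₁ j∈C₁ = inj₁ (∈⋃⁺ C₁ _ j∈C₁ (⊆-updateAt F k j≢k x∈Fj))
    ... | inj₂ j∈C₂ = inj₂ (∈⋃⁺ C₂ _ j∈C₂ (⊆-updateAt F k j≢k x∈Fj))

  ⋃-∩-deletions : ⋃[ C₁ ∩ C₂ - k ] F ∪ (F k - u - w) ⊆ S₁ ∩ S₂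
  ⋃-∩-deletions x∈ with x∈p∪q⁻ (⋃[ C₁ ∩ C₂ - k ] F) _ x∈
  ... | inj₁ x∈⋃ =
    let j , j∈C₁∩C₂-k , x∈Fj = ∈⋃⁻ (C₁ ∩ C₂ - k) F x∈⋃
        j∈C₁∩C₂ , j≢k = x∈p-y⁻ (C₁ ∩ C₂) j∈C₁∩C₂-k
        j∈C₁ , j∈C₂ = x∈p∩q⁻ C₁ C₂ j∈C₁∩C₂
    in x∈p∩q⁺ (∈⋃⁺ C₁ _ j∈C₁ (⊆-updateAt F k j≢k x∈Fj) , ∈⋃⁺ C₂ _ j∈C₂ (⊆-updateAt F k j≢k x∈Fj))
  ... | inj₂ x∈Fk-u-w =
    let x∈Fk-u , x≢w = x∈p-y⁻ (F k - u) x∈Fk-u-w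
    in x∈p∩q⁺ (∈⋃⁺ C₁ _ k∈C₁ (∈-updateAt-updates⁺ F k x∈Fk-u) , ∈S₂ (proj₁ (x∈p-y⁻ (F k) x∈Fk-u)) x≢w)

module _ {X : Subset m} {F : Fin m → Subset n} (expanding : Expanding X F) {k : Fin m} where

  deficient-modification⇒∋k : ∀ {G C} → (∀ {j} → j ≢ k → F j ⊆ G j) → Deficient X G C → k ∈ C
  deficient-modification⇒∋k {G} {C} F⊆G (C⊆X , C-nonempty , ∣⋃C∣≤∣C∣) with k ∈? C
  ... | yes k∈C = k∈C
  ... | no  k∉C = ⊥-elim (<-irrefl refl (<-≤-trans (expanding C C⊆X C-nonempty)
          (≤-trans (p⊆q⇒∣p∣≤∣q∣ (⋃-monoʳ C (λ j∈C → F⊆G (λ { refl → k∉C j∈C })))) ∣⋃C∣≤∣C∣)))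

  expanding-after-deletion : 3 ≤ ∣ F k ∣ → ∀ {u w} → u ∈ F k → w ∈ F k - u →
    Expanding X (updateAt F k (_- u)) ⊎ Expanding X (updateAt F k (_- w))
  expanding-after-deletion 3≤∣Fk∣ {u} {w} u∈Fk w∈Fk-u
    with expanding? X (updateAt F k (_- u)) | expanding? X (updateAt F k (_- w))
  ... | inj₁ expanding-u | _               = inj₁ expanding-u
  ... | inj₂ _          | inj₁ expanding-w = inj₂ expanding-w
  ... | inj₂ (C₁ , deficient₁@(C₁⊆X , _ , ∣S₁∣≤∣C₁∣)) | inj₂ (C₂ , deficient₂@(C₂⊆X , _ , ∣S₂∣≤∣C₂∣)) =
    ⊥-elim (<-irrefl refl (begin-strict
      ∣ A ∣ + ∣ B ∣               <⟨ +-mono-<-≤ ∣A∣<∣⋃A∣ ∣B∣≤∣T∣ ⟩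
      ∣ ⋃[ A ] F ∣ + ∣ T ∣        ≤⟨ +-mono-≤ (p⊆q⇒∣p∣≤∣q∣ (⋃-∪-deletions F k u w k∈C₁ k∈C₂ w≢u))
                                              (p⊆q⇒∣p∣≤∣q∣ (⋃-∩-deletions F k u w k∈C₁ k∈C₂)) ⟩
      ∣ S₁ ∪ S₂ ∣ + ∣ S₁ ∩ S₂ ∣   ≡⟨ ∣p∪q∣+∣p∩q∣≡∣p∣+∣q∣ S₁ S₂ ⟩
      ∣ S₁ ∣ + ∣ S₂ ∣             ≤⟨ +-mono-≤ ∣S₁∣≤∣C₁∣ ∣S₂∣≤∣C₂∣ ⟩
      ∣ C₁ ∣ + ∣ C₂ ∣             ≡⟨ ∣p∪q∣+∣p∩q∣≡∣p∣+∣q∣ C₁ C₂ ⟨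
      ∣ A ∣ + ∣ B ∣               ∎))
    where
    open ≤-Reasoning
    w≢u  = proj₂ (x∈p-y⁻ (F k) w∈Fk-u)
    k∈C₁ = deficient-modification⇒∋k (⊆-updateAt F k) deficient₁
    k∈C₂ = deficient-modification⇒∋k (⊆-updateAt F k) deficient₂
    S₁ = ⋃[ C₁ ] updateAt F k (_- u)
    S₂ = ⋃[ C₂ ] updateAt F k (_- w)
    A = C₁ ∪ C₂
    B = C₁ ∩ C₂
    T = ⋃[ B - k ] F ∪ (F k - u - w)

    ∣A∣<∣⋃A∣ : ∣ A ∣ < ∣ ⋃[ A ] F ∣
    ∣A∣<∣⋃A∣ = expanding A (λ j∈A → [ C₁⊆X , C₂⊆X ]′ (x∈p∪q⁻ C₁ C₂ j∈A)) (k , x∈p∪q⁺ (inj₁ k∈C₁))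

    Fk-u-w-nonempty : Nonempty (F k - u - w)
    Fk-u-w-nonempty = 0<∣p∣⇒Nonempty (F k - u - w) (≤-pred (≤-pred (subst (3 ≤_)
      (trans (x∈p⇒∣p∣≡1+∣p-x∣ (F k) u∈Fk) (cong suc (x∈p⇒∣p∣≡1+∣p-x∣ (F k - u) w∈Fk-u))) 3≤∣Fk∣)))

    ∣B∣≤∣T∣ : ∣ B ∣ ≤ ∣ T ∣
    ∣B∣≤∣T∣ = subst (_≤ ∣ T ∣) (sym (x∈p⇒∣p∣≡1+∣p-x∣ B (x∈p∩q⁺ (k∈C₁ , k∈C₂))))
      (expanding⇒∣C∣<∣S∣ expanding (C₁⊆X ∘ p∩q⊆p C₁ C₂ ∘ p─q⊆p B ⁅ k ⁆) (p⊆p∪q _)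
        (let x , x∈ = Fk-u-w-nonempty in x , q⊆p∪q _ _ x∈))

  deletable-vertex : 3 ≤ ∣ F k ∣ → ∃ λ v → v ∈ F k × Expanding X (updateAt F k (_- v))
  deletable-vertex 3≤∣Fk∣ with two-elements (F k) (≤-trans (n≤1+n 2) 3≤∣Fk∣)
  ... | u , w , u∈Fk , w∈Fk-u with expanding-after-deletion 3≤∣Fk∣ u∈Fk w∈Fk-u
  ...   | inj₁ expanding-u = u , u∈Fk , expanding-u
  ...   | inj₂ expanding-w = w , proj₁ (x∈p-y⁻ (F k) w∈Fk-u) , expanding-w

shrink : ∀ {X : Subset m} s (F : Fin m → Subset n) → weight F < s → Expanding X F →
  ∃ λ G → (∀ k → G k ⊆ F k) × Expanding X G × (∀ {k} → k ∈ X → ∣ G k ∣ ≤ 2)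
shrink {X = X} (suc s) F weight<1+s expanding with any? (λ k → k ∈? X ×-dec 3 ≤? ∣ F k ∣)
... | no no-large = F , (λ _ x∈ → x∈) , expanding , λ k∈X → ≮⇒≥ (λ 3≤ → no-large (_ , k∈X , 3≤))
... | yes (k , k∈X , 3≤∣Fk∣) =
  let v , v∈Fk , expanding′ = deletable-vertex expanding 3≤∣Fk∣
      weight′<s = <-≤-trans (weight-updateAt-< F k (x∈p⇒∣p-x∣<∣p∣ v∈Fk)) (≤-pred weight<1+s)
      G , G⊆ , expandingG , small = shrink s (updateAt F k (_- v)) weight′<s expanding′
  in G , (λ j → updateAt-⊆ F k j ∘ G⊆ j) , expandingG , small

expanding⇒pair-system : ∀ {X : Subset m} {F : Fin m → Subset n} → (∀ k → Nonempty (F k)) → Expanding X F →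
  ∃ λ f → (∀ {k} → k ∈ X → endpoints (f k) ⊆ F k) × Expanding X (endpoints ∘ f)
expanding⇒pair-system {m} {n} {X} {F} F-nonempty expanding with shrink (suc (weight F)) F ≤-refl expanding
... | G , G⊆F , expandingG , ∣G∣≤2 =
  f , (λ k∈X → G⊆F _ ∘ subst (_ ∈_) (sym (G≡endpoints k∈X))) ,
  Expanding-mono (⊆-reflexive ∘ G≡endpoints) expandingG
  where
  pair : ∀ k → Dec (k ∈ X) → ∃ λ ab → k ∈ X → G k ≡ endpoints ab
  pair k (yes k∈X) =
    let ab , Gk≡ab = ∣p∣≡2⇒p≡endpoints (G k) (≤-antisym (∣G∣≤2 k∈X) (expanding⇒2≤∣F∣ expandingG k∈X))
    in ab , λ _ → Gk≡ab
  pair k (no k∉X) = let v , _ = F-nonempty k in (v , v) , λ k∈X → ⊥-elim (k∉X k∈X)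

  f : Fin m → Fin n × Fin n
  f k = proj₁ (pair k (k ∈? X))

  G≡endpoints : ∀ {k} → k ∈ X → G k ≡ endpoints (f k)
  G≡endpoints {k} = proj₂ (pair k (k ∈? X))

fromList : List (Fin n) → Subset n
fromList []       = ⊥
fromList (x ∷ xs) = ⁅ x ⁆ ∪ fromList xs

∈fromList⁺ : ∀ {x : Fin n} {xs} → x ∈ˡ xs → x ∈ fromList xs
∈fromList⁺ (here refl) = x∈p∪q⁺ (inj₁ (x∈⁅x⁆ _))
∈fromList⁺ (there x∈)  = x∈p∪q⁺ (inj₂ (∈fromList⁺ x∈))

∈fromList⁻ : ∀ {x : Fin n} xs → x ∈ fromList xs → x ∈ˡ xs
∈fromList⁻ []       x∈ = ⊥-elim (∉⊥ x∈)
∈fromList⁻ (y ∷ xs) x∈ = [ here , there ∘ ∈fromList⁻ xs ]′ (x∈⁅y⁆∪p⁻ (fromList xs) x∈)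

∣fromList∣≡length : ∀ {xs : List (Fin n)} → Unique xs → ∣ fromList xs ∣ ≡ length xs
∣fromList∣≡length {n} []                   = ∣⊥∣≡0 n
∣fromList∣≡length {xs = x ∷ xs} (x∉ ∷ unique) =
  trans (x∉p⇒∣⁅x⁆∪p∣≡1+∣p∣ (fromList xs) (All¬⇒¬Any x∉ ∘ ∈fromList⁻ xs))
        (cong suc (∣fromList∣≡length unique))

Unique⇒length≤n : ∀ {xs : List (Fin n)} → Unique xs → length xs ≤ n
Unique⇒length≤n {xs = xs} unique = subst (_≤ _) (∣fromList∣≡length unique) (∣p∣≤n (fromList xs))

Linked-take-∷ʳ : ∀ {A : Set} {R : A → A → Set} {a w b : A} {xs} →
                 Linked R (a ∷ xs) → (w∈ : w ∈ˡ xs) → R w b →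
                 Linked R (a ∷ take (suc (toℕ (index w∈))) xs ++ [ b ])
Linked-take-∷ʳ (Raw ∷ _)   (here refl) Rwb = Raw ∷ Rwb ∷ [-]
Linked-take-∷ʳ (Rax ∷ Rxs) (there w∈)  Rwb = Rax ∷ Linked-take-∷ʳ Rxs w∈ Rwb

0<length-take-suc : ∀ {A : Set} {w : A} {xs} (w∈ : w ∈ˡ xs) → 0 < length (take (suc (toℕ (index w∈))) xs)
0<length-take-suc (here _)  = s≤s z≤n
0<length-take-suc (there _) = s≤s z≤n

module _ {R : Fin n → Fin n → Set} where

  walk-∷ʳ : ∀ {u a b} → Walk R u a → R a b → Walk R u b
  walk-∷ʳ here         Rab = step Rab here
  walk-∷ʳ (step Ruv w) Rab = step Ruv (walk-∷ʳ w Rab)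

  Crossing : Subset n → Set
  Crossing T = ∃₂ λ z y → z ∈ T × y ∉ T × R z y

  walk⇒crossing : ∀ {T a b} → Walk R a b → a ∈ T → b ∉ T → Crossing T
  walk⇒crossing here a∈T a∉T = ⊥-elim (a∉T a∈T)
  walk⇒crossing {T} (step {v = v} Rav w) a∈T b∉T with v ∈? T
  ... | yes v∈T = walk⇒crossing w v∈T b∉T
  ... | no  v∉T = _ , v , a∈T , v∉T , Rav

close-cycle : ∀ {R : Fin n → Fin n → Set} {h p w rest} → Unique (h ∷ p ∷ rest) → Linked R (h ∷ p ∷ rest) →
              w ∈ˡ rest → R w h → GraphCycle R
close-cycle {h = h} {p} {rest = rest} unique linked w∈rest Rwh = record
  { start    = h
  ; rest     = p ∷ take (suc (toℕ (index w∈rest))) rest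
  ; long     = s≤s (0<length-take-suc w∈rest)
  ; distinct = Unique.take⁺ (3 + toℕ (index w∈rest)) unique
  ; closed   = Linked-take-∷ʳ linked (there w∈rest) Rwh
  }

grow-to-⊤ : ∀ (P : Subset n → Set) → (∀ {T x} → x ∉ T → P T → ∃ λ y → y ∉ T × P (⁅ y ⁆ ∪ T)) →
            ∀ {T} → P T → P ⊤
grow-to-⊤ {n} P extend {T} = go n T (m≤n+m n ∣ T ∣)
  where
  go : ∀ fuel T → n ≤ ∣ T ∣ + fuel → P T → P ⊤
  go fuel T bound PT with all? (_∈? T)
  ... | yes all∈T = subst P (⊆-antisym ⊆⊤ (λ {x} _ → all∈T x)) PT
  go zero T bound PT | no ¬all∈T =
    let x , x∉T = ¬∀⟶∃¬ n _ (_∈? T) ¬all∈T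
    in ⊥-elim (<-irrefl refl (≤-trans (subst (_≤ n) (x∉p⇒∣⁅x⁆∪p∣≡1+∣p∣ T x∉T) (∣p∣≤n (⁅ x ⁆ ∪ T)))
                                      (subst (n ≤_) (+-identityʳ _) bound)))
  go (suc fuel) T bound PT | no ¬all∈T =
    let x , x∉T = ¬∀⟶∃¬ n _ (_∈? T) ¬all∈T
        y , y∉T , P[y∪T] = extend x∉T PT
    in go fuel (⁅ y ⁆ ∪ T)
          (subst (n ≤_) (trans (+-suc _ _) (cong (_+ fuel) (sym (x∉p⇒∣⁅x⁆∪p∣≡1+∣p∣ T y∉T)))) bound) P[y∪T]

-- Graphs of pairs

SamePair-sym : ∀ {ab cd : Fin n × Fin n} → SamePair ab cd → SamePair cd ab
SamePair-sym (inj₁ (refl , refl)) = inj₁ (refl , refl)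
SamePair-sym (inj₂ (refl , refl)) = inj₂ (refl , refl)

SamePair-trans : ∀ {ab cd ef : Fin n × Fin n} → SamePair ab cd → SamePair cd ef → SamePair ab ef
SamePair-trans (inj₁ (refl , refl)) cd~ef                = cd~ef
SamePair-trans (inj₂ (refl , refl)) (inj₁ (refl , refl)) = inj₂ (refl , refl)
SamePair-trans (inj₂ (refl , refl)) (inj₂ (refl , refl)) = inj₁ (refl , refl)

SamePair-swap : ∀ {ab : Fin n × Fin n} {u v} → SamePair ab (u , v) → SamePair ab (v , u)
SamePair-swap (inj₁ (refl , refl)) = inj₂ (refl , refl)
SamePair-swap (inj₂ (refl , refl)) = inj₁ (refl , refl)

SamePair⇒endpoints≡ : ∀ {ab cd : Fin n × Fin n} → SamePair ab cd → endpoints ab ≡ endpoints cd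
SamePair⇒endpoints≡ (inj₁ (refl , refl)) = refl
SamePair⇒endpoints≡ (inj₂ (refl , refl)) = ∪-comm _ _

SamePair-loop : ∀ {ab : Fin n × Fin n} {u} → SamePair ab (u , u) → proj₁ ab ≡ proj₂ ab
SamePair-loop (inj₁ (refl , refl)) = refl
SamePair-loop (inj₂ (refl , refl)) = refl

other-endpoint : ∀ {u : Fin n} ab → u ∈ endpoints ab → ∃ λ v → SamePair ab (u , v)
other-endpoint (a , b) u∈ with ∈endpoints⁻ (a , b) u∈
... | inj₁ refl = b , inj₁ (refl , refl)
... | inj₂ refl = a , inj₂ (refl , refl)

SamePair⇒∈endpoints : ∀ {ab : Fin n × Fin n} {u v} → SamePair ab (u , v) → u ∈ endpoints ab × v ∈ endpoints ab
SamePair⇒∈endpoints {u = u} {v} ab~uv rewrite SamePair⇒endpoints≡ ab~uv =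
  proj₁∈endpoints (u , v) , proj₂∈endpoints (u , v)

∣endpoints∣≡1 : ∀ {ab : Fin n × Fin n} → proj₁ ab ≡ proj₂ ab → ∣ endpoints ab ∣ ≡ 1
∣endpoints∣≡1 {ab = a , .a} refl = trans (cong ∣_∣ (∪-idem ⁅ a ⁆)) (∣⁅x⁆∣≡1 a)

Separates : Subset n → Fin n × Fin n → Set
Separates T (a , b) = a ∈ T × b ∉ T ⊎ b ∈ T × a ∉ T

separates? : ∀ (T : Subset n) ab → Dec (Separates T ab)
separates? T (a , b) = (a ∈? T ×-dec ¬? (b ∈? T)) ⊎-dec (b ∈? T ×-dec ¬? (a ∈? T))

module _ {X : Subset m} {f : Fin m → Fin n × Fin n} where

  private
    P : Fin m → Subset n
    P = endpoints ∘ f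

    Adj : Fin n → Fin n → Set
    Adj = PairGraph X f

  Spans : Subset m → Subset n → Set
  Spans C V = C ⊆ X × ⋃[ C ] P ⊆ V × ∣ V ∣ ≡ suc ∣ C ∣

  ∣V∣≡1⇒Spans⊥ : ∀ {V} → ∣ V ∣ ≡ 1 → Spans ⊥ V
  ∣V∣≡1⇒Spans⊥ ∣V∣≡1 =
    (λ k∈⊥ → ⊥-elim (∉⊥ k∈⊥)) , ⋃⊆ {C = ⊥} {F = P} (λ k∈⊥ → ⊥-elim (∉⊥ k∈⊥)) ,
    trans ∣V∣≡1 (cong suc (sym (∣⊥∣≡0 m)))

  Spans-extend : ∀ {C V y z k} → Spans C V → y ∉ V → z ∈ V → k ∈ X → SamePair (f k) (z , y) →
                 Spans (⁅ k ⁆ ∪ C) (⁅ y ⁆ ∪ V)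
  Spans-extend {C} {V} {y} {z} {k} (C⊆X , ⋃C⊆V , ∣V∣≡1+∣C∣) y∉V z∈V k∈X fk~zy =
    ⁅x⁆∪p⊆q k∈X C⊆X , ⋃⊆ ⊆⁅y⁆∪V , cardinality
    where
    y∈Pk = proj₂ (SamePair⇒∈endpoints fk~zy)
    k∉C : k ∉ C
    k∉C k∈C = y∉V (⋃C⊆V (∈⋃⁺ C P k∈C y∈Pk))
    ⊆⁅y⁆∪V : ∀ {j} → j ∈ ⁅ k ⁆ ∪ C → P j ⊆ ⁅ y ⁆ ∪ V
    ⊆⁅y⁆∪V j∈ with x∈⁅y⁆∪p⁻ C j∈
    ... | inj₁ refl = subst (_⊆ ⁅ y ⁆ ∪ V) (sym (SamePair⇒endpoints≡ fk~zy))
                            (endpoints⊆ (x∈p∪q⁺ (inj₂ z∈V)) (x∈p∪q⁺ (inj₁ (x∈⁅x⁆ y))))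
    ... | inj₂ j∈C  = x∈p∪q⁺ ∘ inj₂ ∘ ⋃C⊆V ∘ ∈⋃⁺ C P j∈C
    cardinality : ∣ ⁅ y ⁆ ∪ V ∣ ≡ suc ∣ ⁅ k ⁆ ∪ C ∣
    cardinality = trans (x∉p⇒∣⁅x⁆∪p∣≡1+∣p∣ V y∉V)
                        (cong suc (trans ∣V∣≡1+∣C∣ (sym (x∉p⇒∣⁅x⁆∪p∣≡1+∣p∣ C k∉C))))

  path⇒Spans : ∀ {y L} → Unique (y ∷ L) → Linked Adj (y ∷ L) → ∃ λ C → Spans C (fromList (y ∷ L))
  path⇒Spans {y} {[]} _ _ =
    ⊥ , ∣V∣≡1⇒Spans⊥ (trans (x∉p⇒∣⁅x⁆∪p∣≡1+∣p∣ {x = y} ⊥ ∉⊥) (cong suc (∣⊥∣≡0 n)))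
  path⇒Spans {y} {z ∷ L} (y∉ ∷ unique) ((k , k∈X , fk~yz) ∷ linked) =
    let C , spans = path⇒Spans unique linked
    in ⁅ k ⁆ ∪ C , Spans-extend spans (All¬⇒¬Any y∉ ∘ ∈fromList⁻ (z ∷ L))
                                 (∈fromList⁺ {xs = z ∷ L} (here refl)) k∈X (SamePair-swap fk~yz)

  module _ (expanding : Expanding X P) where

    expanding⇒loopless : ∀ {k} → k ∈ X → proj₁ (f k) ≢ proj₂ (f k)
    expanding⇒loopless k∈X a≡b = 1+n≰n (subst (2 ≤_) (∣endpoints∣≡1 a≡b) (expanding⇒2≤∣F∣ expanding k∈X))

    expanding⇒injective : ∀ {k l} → k ∈ X → l ∈ X → SamePair (f k) (f l) → k ≡ l
    expanding⇒injective {k} {l} k∈X l∈X fk~fl with k ≟ l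
    ... | yes k≡l = k≡l
    ... | no  k≢l = ⊥-elim (<-irrefl refl (begin-strict
      2                     ≡⟨ ∣endpoints∣≡2 k≢l ⟨
      ∣ C ∣                 <⟨ expanding C (endpoints⊆ k∈X l∈X) (k , proj₁∈endpoints (k , l)) ⟩
      ∣ ⋃[ C ] P ∣          ≤⟨ p⊆q⇒∣p∣≤∣q∣ (⋃⊆ {C = C} ⊆Pk) ⟩
      ∣ P k ∣               ≤⟨ ∣endpoints∣≤2 (f k) ⟩
      2                     ∎))
      where
      open ≤-Reasoning
      C = endpoints (k , l)
      ⊆Pk : ∀ {j} → j ∈ C → P j ⊆ P k
      ⊆Pk j∈C with ∈endpoints⁻ (k , l) j∈C
      ... | inj₁ refl = λ x∈ → x∈
      ... | inj₂ refl = subst (_ ∈_) (SamePair⇒endpoints≡ (SamePair-sym fk~fl))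

    Spans-edge⇒∈ : ∀ {C V k} → Spans C V → k ∈ X → P k ⊆ V → k ∈ C
    Spans-edge⇒∈ {C} {V} {k} (C⊆X , ⋃C⊆V , ∣V∣≡1+∣C∣) k∈X Pk⊆V with k ∈? C
    ... | yes k∈C = k∈C
    ... | no  k∉C = ⊥-elim (<-irrefl refl (begin-strict
      ∣ ⁅ k ⁆ ∪ C ∣         <⟨ expanding (⁅ k ⁆ ∪ C) (⁅x⁆∪p⊆q k∈X C⊆X) (k , x∈p∪q⁺ (inj₁ (x∈⁅x⁆ k))) ⟩
      ∣ ⋃[ ⁅ k ⁆ ∪ C ] P ∣   ≤⟨ p⊆q⇒∣p∣≤∣q∣ (⋃⊆ {C = ⁅ k ⁆ ∪ C} ⊆V) ⟩
      ∣ V ∣                 ≡⟨ trans ∣V∣≡1+∣C∣ (sym (x∉p⇒∣⁅x⁆∪p∣≡1+∣p∣ C k∉C)) ⟩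
      ∣ ⁅ k ⁆ ∪ C ∣         ∎))
      where
      open ≤-Reasoning
      ⊆V : ∀ {j} → j ∈ ⁅ k ⁆ ∪ C → P j ⊆ V
      ⊆V j∈ with x∈⁅y⁆∪p⁻ C j∈
      ... | inj₁ refl = Pk⊆V
      ... | inj₂ j∈C  = ⋃C⊆V ∘ ∈⋃⁺ C P j∈C

    -- The edges x₁x₂, …, xₖs span the vertices of the cycle s x₁ … xₖ, and the edge sx₁ lies inside
    -- them without being one of them: x₁x₂ avoids s, and the edges of the path x₂ … xₖ s avoid x₁.
    expanding⇒acyclic : IsForestG Adj
    expanding⇒acyclic record { rest = [] ; long = () }
    expanding⇒acyclic record { rest = _ ∷ [] ; long = s≤s () }
    expanding⇒acyclic record { start = s ; rest = x₁ ∷ x₂ ∷ L ; distinct = (s≢x₁ ∷ s∉x₂L) ∷ x₁∉ ∷ unique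
                             ; closed = (k₀ , k₀∈X , fk₀~sx₁) ∷ (k₁ , k₁∈X , fk₁~x₁x₂) ∷ linked } =
      k₀∉ (Spans-edge⇒∈ spans k₀∈X Pk₀⊆V)
      where
      path = x₂ ∷ L ++ [ s ]
      unique-path : Unique path
      unique-path = Unique.++⁺ unique ([] ∷ []) λ { (s∈ , here refl) → All¬⇒¬Any s∉x₂L s∈ }
      x₁∉path : x₁ ∉ fromList path
      x₁∉path x₁∈ with ∈-++⁻ (x₂ ∷ L) (∈fromList⁻ path x₁∈)
      ... | inj₁ x₁∈x₂L        = All¬⇒¬Any x₁∉ x₁∈x₂L
      ... | inj₂ (here x₁≡s)   = s≢x₁ (sym x₁≡s)
      C₁ = proj₁ (path⇒Spans unique-path linked)
      spans₁ = proj₂ (path⇒Spans unique-path linked)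
      spans : Spans (⁅ k₁ ⁆ ∪ C₁) (⁅ x₁ ⁆ ∪ fromList path)
      spans = Spans-extend spans₁ x₁∉path (∈fromList⁺ {xs = path} (here refl)) k₁∈X (SamePair-swap fk₁~x₁x₂)
      Pk₀⊆V : P k₀ ⊆ ⁅ x₁ ⁆ ∪ fromList path
      Pk₀⊆V = subst (_⊆ ⁅ x₁ ⁆ ∪ fromList path) (sym (SamePair⇒endpoints≡ fk₀~sx₁))
        (endpoints⊆ (x∈p∪q⁺ (inj₂ (∈fromList⁺ {xs = path} (∈-++⁺ʳ (x₂ ∷ L) (here refl)))))
                    (x∈p∪q⁺ (inj₁ (x∈⁅x⁆ x₁))))
      k₀∉ : k₀ ∉ ⁅ k₁ ⁆ ∪ C₁
      k₀∉ k₀∈ with x∈⁅y⁆∪p⁻ C₁ k₀∈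
      ... | inj₁ refl with ∈endpoints⁻ (x₁ , x₂) (subst (s ∈_)
                             (trans (sym (SamePair⇒endpoints≡ fk₀~sx₁)) (SamePair⇒endpoints≡ fk₁~x₁x₂))
                             (proj₁∈endpoints (s , x₁)))
      ...   | inj₁ s≡x₁ = s≢x₁ s≡x₁
      ...   | inj₂ s≡x₂ = All¬⇒¬Any s∉x₂L (here s≡x₂)
      k₀∉ k₀∈ | inj₂ k₀∈C₁ =
        x₁∉path (proj₁ (proj₂ spans₁) (∈⋃⁺ C₁ P k₀∈C₁ (proj₂ (SamePair⇒∈endpoints fk₀~sx₁))))

    ¬separating⇒2+∣X∣≤n : ∀ {T z x} → (∀ {j} → j ∈ X → ¬ Separates T (f j)) → z ∈ T → x ∉ T → 2 + ∣ X ∣ ≤ n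
    ¬separating⇒2+∣X∣≤n {T} {z} {x} ¬separating z∈T x∉T = begin
      2 + ∣ X ∣                       ≡⟨ cong (2 +_) (∣p∣≡∣p∩q∣+∣p∩∁q∣ X Q) ⟩
      2 + (∣ X ∩ Q ∣ + ∣ X ∩ ∁ Q ∣)    ≡⟨ cong suc (+-suc _ _) ⟨
      suc ∣ X ∩ Q ∣ + suc ∣ X ∩ ∁ Q ∣  ≤⟨ +-mono-≤
        (expanding⇒∣C∣<∣S∣ expanding (p∩q⊆p X Q) ⋃[X∩Q]⊆T (z , z∈T))
        (expanding⇒∣C∣<∣S∣ expanding (p∩q⊆p X (∁ Q)) ⋃[X∩∁Q]⊆∁T (x , x∉p⇒x∈∁p x∉T)) ⟩
      ∣ T ∣ + ∣ ∁ T ∣                  ≡⟨ cong (∣ T ∣ +_) (∣∁p∣≡n∸∣p∣ T) ⟩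
      ∣ T ∣ + (n ∸ ∣ T ∣)              ≡⟨ m+[n∸m]≡n (∣p∣≤n T) ⟩
      n                               ∎
      where
      open ≤-Reasoning
      Q = preimage (proj₁ ∘ f) T
      ⋃[X∩Q]⊆T : ⋃[ X ∩ Q ] P ⊆ T
      ⋃[X∩Q]⊆T = ⋃⊆ {C = X ∩ Q} λ {j} j∈ → let j∈X , j∈Q = x∈p∩q⁻ X Q j∈ in ⊆T j∈X (∈preimage⁻ j∈Q)
        where
        ⊆T : ∀ {j} → j ∈ X → proj₁ (f j) ∈ T → P j ⊆ T
        ⊆T {j} j∈X a∈T with proj₂ (f j) ∈? T
        ... | yes b∈T = endpoints⊆ a∈T b∈T
        ... | no  b∉T = ⊥-elim (¬separating j∈X (inj₁ (a∈T , b∉T)))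
      ⋃[X∩∁Q]⊆∁T : ⋃[ X ∩ ∁ Q ] P ⊆ ∁ T
      ⋃[X∩∁Q]⊆∁T = ⋃⊆ {C = X ∩ ∁ Q} λ {j} j∈ →
        let j∈X , j∈∁Q = x∈p∩q⁻ X (∁ Q) j∈ in ⊆∁T j∈X (x∈∁p⇒x∉p j∈∁Q ∘ ∈preimage⁺)
        where
        ⊆∁T : ∀ {j} → j ∈ X → proj₁ (f j) ∉ T → P j ⊆ ∁ T
        ⊆∁T {j} j∈X a∉T with proj₂ (f j) ∈? T
        ... | yes b∈T = ⊥-elim (¬separating j∈X (inj₂ (b∈T , a∉T)))
        ... | no  b∉T = endpoints⊆ (x∉p⇒x∈∁p a∉T) (x∉p⇒x∈∁p b∉T)

    expanding⇒crossing : ∣ X ∣ ≡ n ∸ 1 → ∀ {T z x} → z ∈ T → x ∉ T → Crossing {R = Adj} T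
    expanding⇒crossing ∣X∣≡n∸1 {T} z∈T x∉T with any? (λ j → j ∈? X ×-dec separates? T (f j))
    ... | yes (j , j∈X , inj₁ (a∈T , b∉T)) = _ , _ , a∈T , b∉T , j , j∈X , inj₁ (refl , refl)
    ... | yes (j , j∈X , inj₂ (b∈T , a∉T)) = _ , _ , b∈T , a∉T , j , j∈X , inj₂ (refl , refl)
    ... | no ¬separating = ⊥-elim (1+n≰n (≤-trans (s≤s (m≤n+m∸n n 1))
          (subst (λ s → 2 + s ≤ n) ∣X∣≡n∸1
            (¬separating⇒2+∣X∣≤n (λ j∈X sep → ¬separating (_ , j∈X , sep)) z∈T x∉T))))

    expanding⇒connected : ∣ X ∣ ≡ n ∸ 1 → IsConnectedG Adj
    expanding⇒connected ∣X∣≡n∸1 u v = proj₂ (grow-to-⊤ Reachable extend (x∈⁅x⁆ u , from⁅u⁆)) ∈⊤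
      where
      Reachable : Subset n → Set
      Reachable T = u ∈ T × (∀ {x} → x ∈ T → Walk Adj u x)
      from⁅u⁆ : ∀ {x} → x ∈ ⁅ u ⁆ → Walk Adj u x
      from⁅u⁆ x∈⁅u⁆ rewrite x∈⁅y⁆⇒x≡y u x∈⁅u⁆ = here
      extend : ∀ {T x} → x ∉ T → Reachable T → ∃ λ y → y ∉ T × Reachable (⁅ y ⁆ ∪ T)
      extend {T} x∉T (u∈T , reach) =
        let z , y , z∈T , y∉T , z~y = expanding⇒crossing ∣X∣≡n∸1 u∈T x∉T
        in y , y∉T , x∈p∪q⁺ (inj₂ u∈T) ,
           λ x∈ → [ (λ { refl → walk-∷ʳ (reach z∈T) z~y }) , reach ]′ (x∈⁅y⁆∪p⁻ T x∈)

  connected⇒n≤1+∣X∣ : IsConnectedG Adj → Fin n → n ≤ suc ∣ X ∣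
  connected⇒n≤1+∣X∣ connected r =
    let _ , C , C⊆X , _ , ∣⊤∣≡1+∣C∣ = grow-to-⊤ Spanned extend (x∈⁅x⁆ r , ⊥ , ∣V∣≡1⇒Spans⊥ (∣⁅x⁆∣≡1 r))
    in subst (_≤ suc ∣ X ∣) (trans (sym ∣⊤∣≡1+∣C∣) (∣⊤∣≡n n)) (s≤s (p⊆q⇒∣p∣≤∣q∣ C⊆X))
    where
    Spanned : Subset n → Set
    Spanned T = r ∈ T × ∃ λ C → Spans C T
    extend : ∀ {T x} → x ∉ T → Spanned T → ∃ λ y → y ∉ T × Spanned (⁅ y ⁆ ∪ T)
    extend x∉T (r∈T , C , spans) =
      let z , y , z∈T , y∉T , k , k∈X , fk~zy = walk⇒crossing (connected r _) r∈T x∉T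
      in y , y∉T , x∈p∪q⁺ (inj₂ r∈T) , ⁅ k ⁆ ∪ C , Spans-extend spans y∉T z∈T k∈X fk~zy

  module _ (loopless : ∀ k → k ∈ X → proj₁ (f k) ≢ proj₂ (f k))
           (injective : ∀ k l → k ∈ X → l ∈ X → SamePair (f k) (f l) → k ≡ l) where

    Leaf : Subset m → Fin m → Fin n → Set
    Leaf C k h = k ∈ C × h ∈ P k × (∀ {j} → j ∈ C → h ∈ P j → j ≡ k)

    -- Extend the path at its head h along an edge of C other than the last one used;
    -- this ends in a cycle or at a leaf, since a simple path has at most n vertices.
    grow-path : ∀ fuel {C} → C ⊆ X → ∀ {h p rest k} → k ∈ C → SamePair (f k) (h , p) →
      Unique (h ∷ p ∷ rest) → Linked Adj (h ∷ p ∷ rest) → suc n ≤ length (h ∷ p ∷ rest) + fuel →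
      GraphCycle Adj ⊎ ∃₂ (Leaf C)
    grow-path zero _ _ _ unique _ bound =
      ⊥-elim (1+n≰n (≤-trans bound (≤-trans (≤-reflexive (+-identityʳ _)) (Unique⇒length≤n unique))))
    grow-path (suc fuel) {C} C⊆X {h} {p} {rest} {k} k∈C fk~hp unique linked bound
      with any? (λ j → j ∈? C ×-dec ¬? (j ≟ k) ×-dec h ∈? P j)
    ... | no no-other = inj₂ (k , h , k∈C , proj₁ (SamePair⇒∈endpoints fk~hp) ,
      λ {j} j∈C h∈Pj → decidable-stable (j ≟ k) (λ j≢k → no-other (j , j∈C , j≢k , h∈Pj)))
    ... | yes (j , j∈C , j≢k , h∈Pj) with other-endpoint (f j) h∈Pj
    ...   | w , fj~hw with Any.any? (w ≟_) (h ∷ p ∷ rest)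
    ...     | yes (here refl)           = ⊥-elim (loopless j (C⊆X j∈C) (SamePair-loop fj~hw))
    ...     | yes (there (here refl))    =
      ⊥-elim (j≢k (injective j k (C⊆X j∈C) (C⊆X k∈C) (SamePair-trans fj~hw (SamePair-sym fk~hp))))
    ...     | yes (there (there w∈rest)) = inj₁ (close-cycle unique linked w∈rest w~h)
      where w~h = j , C⊆X j∈C , SamePair-swap fj~hw
    ...     | no w∉path = grow-path fuel C⊆X j∈C (SamePair-swap fj~hw) (¬Any⇒All¬ _ w∉path ∷ unique)
                                    (w~h ∷ linked) (subst (suc n ≤_) (+-suc _ fuel) bound)
      where w~h = j , C⊆X j∈C , SamePair-swap fj~hw

    prune-leaf : ∀ {C k h} → Deficient X P C → Leaf C k h → Deficient X P (C - k)
    prune-leaf {C} {k} {h} (C⊆X , _ , ∣⋃C∣≤∣C∣) (k∈C , h∈Pk , only-k) =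
      C⊆X ∘ p─q⊆p C ⁅ k ⁆ , 0<∣p∣⇒Nonempty (C - k) 0<∣C-k∣ , ≤-pred ∣⋃[C-k]∣<∣C∣
      where
      open ≤-Reasoning
      ∣C∣≡1+∣C-k∣ = x∈p⇒∣p∣≡1+∣p-x∣ C k∈C
      ⋃[C-k]⊆⋃C-h : ⋃[ C - k ] P ⊆ ⋃[ C ] P - h
      ⋃[C-k]⊆⋃C-h = ⋃⊆ {C = C - k} λ {j} j∈C-k {x} x∈Pj →
        let j∈C , j≢k = x∈p-y⁻ C j∈C-k
        in x∈p∧x≢y⇒x∈p-y (∈⋃⁺ C P j∈C x∈Pj) (λ { refl → j≢k (only-k j∈C x∈Pj) })
      ∣⋃[C-k]∣<∣C∣ : suc ∣ ⋃[ C - k ] P ∣ ≤ suc ∣ C - k ∣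
      ∣⋃[C-k]∣<∣C∣ = begin
        suc ∣ ⋃[ C - k ] P ∣   ≤⟨ s≤s (p⊆q⇒∣p∣≤∣q∣ ⋃[C-k]⊆⋃C-h) ⟩
        suc ∣ ⋃[ C ] P - h ∣   ≡⟨ x∈p⇒∣p∣≡1+∣p-x∣ (⋃[ C ] P) (∈⋃⁺ C P k∈C h∈Pk) ⟨
        ∣ ⋃[ C ] P ∣           ≤⟨ ∣⋃C∣≤∣C∣ ⟩
        ∣ C ∣                  ≡⟨ ∣C∣≡1+∣C-k∣ ⟩
        suc ∣ C - k ∣          ∎
      0<∣C-k∣ : 0 < ∣ C - k ∣
      0<∣C-k∣ = ≤-pred (begin
        2                      ≡⟨ ∣endpoints∣≡2 (loopless k (C⊆X k∈C)) ⟨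
        ∣ P k ∣                ≤⟨ p⊆q⇒∣p∣≤∣q∣ (∈⋃⁺ C P k∈C) ⟩
        ∣ ⋃[ C ] P ∣           ≤⟨ ∣⋃C∣≤∣C∣ ⟩
        ∣ C ∣                  ≡⟨ ∣C∣≡1+∣C-k∣ ⟩
        suc ∣ C - k ∣          ∎)

    deficient⇒graph-cycle : ∀ s C → ∣ C ∣ ≤ s → Deficient X P C → GraphCycle Adj
    deficient⇒graph-cycle zero C ∣C∣≤0 (_ , (k , k∈C) , _) =
      ⊥-elim (n≮0 (<-≤-trans (x∈p⇒0<∣p∣ C k∈C) ∣C∣≤0))
    deficient⇒graph-cycle (suc s) C ∣C∣≤1+s deficient@(C⊆X , (k , k∈C) , _)
      with grow-path n C⊆X k∈C (inj₁ (refl , refl)) ((loopless k (C⊆X k∈C) ∷ []) ∷ [] ∷ [])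
                     ((k , C⊆X k∈C , inj₁ (refl , refl)) ∷ [-]) (s≤s (n≤1+n n))
    ... | inj₁ cycle = cycle
    ... | inj₂ (l , h , leaf@(l∈C , _)) = deficient⇒graph-cycle s (C - l)
          (≤-pred (<-≤-trans (x∈p⇒∣p-x∣<∣p∣ l∈C) ∣C∣≤1+s)) (prune-leaf deficient leaf)

    acyclic⇒expanding : IsForestG Adj → Expanding X P
    acyclic⇒expanding acyclic with expanding? X P
    ... | inj₁ expanding = expanding
    ... | inj₂ (C , deficient) = ⊥-elim (acyclic (deficient⇒graph-cycle m C (∣p∣≤n C) deficient))

connected⇒n∸1≤∣X∣ : ∀ n {X : Subset m} {f : Fin m → Fin n × Fin n} →
                    IsConnectedG (PairGraph X f) → n ∸ 1 ≤ ∣ X ∣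
connected⇒n∸1≤∣X∣ zero    _         = z≤n
connected⇒n∸1≤∣X∣ (suc n) connected = ≤-pred (connected⇒n≤1+∣X∣ connected zero)

module _ {E : Fin m → Subset n} {X : Subset m} {f : Fin m → Fin n × Fin n} where

  expanding⇒ValidAssignment : (∀ {k} → k ∈ X → endpoints (f k) ⊆ E k) → Expanding X (endpoints ∘ f) →
                              ValidAssignment E X f
  expanding⇒ValidAssignment endpoints⊆E expanding =
    (λ k k∈X → expanding⇒loopless expanding k∈X ,
               endpoints⊆E k∈X (proj₁∈endpoints (f k)) , endpoints⊆E k∈X (proj₂∈endpoints (f k))) ,
    λ k l → expanding⇒injective expanding

  ValidAssignment∧acyclic⇒expanding : ValidAssignment E X f → IsForestG (PairGraph X f) → Expanding X E
  ValidAssignment∧acyclic⇒expanding (in-edges , injective) acyclic =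
    Expanding-mono (λ {k} k∈X → let _ , a∈Ek , b∈Ek = in-edges k k∈X in endpoints⊆ a∈Ek b∈Ek)
                   (acyclic⇒expanding (λ k → proj₁ ∘ in-edges k) injective acyclic)

mainTheorem11 : (n m : ℕ) (E : Fin m → Subset n) →
    (∀ k → Nonempty (E k)) → Injective _≡_ _≡_ E → (X : Subset m) →
    (IsSpanningForest E X ⇔
      Σ (Fin m → Fin n × Fin n) (λ f → ValidAssignment E X f × IsForestG (PairGraph X f)))
    ×
    (IsSpanningTree E X ⇔
      Σ (Fin m → Fin n × Fin n) (λ f → ValidAssignment E X f × IsSpanningTreeG (PairGraph X f)))
mainTheorem11 n m E edges-nonempty _ X = mk⇔ forest⇒ ⇐forest , mk⇔ tree⇒ ⇐tree
  where
  realise : IsSpanningForest E X → ∃ λ f → ValidAssignment E X f × Expanding X (endpoints ∘ f)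
  realise forest =
    let f , endpoints⊆E , expanding =
          expanding⇒pair-system edges-nonempty (forest⇒expanding edges-nonempty forest)
    in f , expanding⇒ValidAssignment endpoints⊆E expanding , expanding

  forest⇒ : IsSpanningForest E X → ∃ λ f → ValidAssignment E X f × IsForestG (PairGraph X f)
  forest⇒ forest = let f , valid , expanding = realise forest in f , valid , expanding⇒acyclic expanding

  ⇐forest : ∃ (λ f → ValidAssignment E X f × IsForestG (PairGraph X f)) → IsSpanningForest E X
  ⇐forest (f , valid , acyclic) = expanding⇒forest (ValidAssignment∧acyclic⇒expanding valid acyclic)

  tree⇒ : IsSpanningTree E X → ∃ λ f → ValidAssignment E X f × IsSpanningTreeG (PairGraph X f)
  tree⇒ (forest , ∣X∣≡n∸1) =
    let f , valid , expanding = realise forest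
    in f , valid , expanding⇒acyclic expanding , expanding⇒connected expanding ∣X∣≡n∸1

  ⇐tree : ∃ (λ f → ValidAssignment E X f × IsSpanningTreeG (PairGraph X f)) → IsSpanningTree E X
  ⇐tree (f , valid , acyclic , connected) =
    ⇐forest (f , valid , acyclic) ,
    ≤-antisym (expanding⇒∣X∣≤n∸1 (ValidAssignment∧acyclic⇒expanding valid acyclic))
              (connected⇒n∸1≤∣X∣ n connected)
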